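{- Let $k\in\mathbb{Z}$ and $n,d\in\mathbb{Z}^+$. For $\alpha\in\mathbb{Z}$ let \[f(\alpha,t)=\frac{(k-\alpha)t+\alpha}{(1-t)(2t^2+t+1)}=\sum_{i=0}^\infty f_i(\alpha)t^i\] be the expansion as a formal power series in $t$. Then $\chi_{n,k}(T_{2,d})$ exists if and only if there exists $\alpha\in\mathbb{Z}$ such that $f_{d+1}(\alpha)\equiv0\pmod n$.
   Context: $T_{2,d}$ is the rooted perfect binary tree of height $d$: the root is at level $0$, every vertex at level $i<d$ has exactly two children (at level $i+1$), and the vertices at level $d$ are leaves. For a graph $G=(V,E)$, a labeling $\ell:V\to\mathbb{Z}$ is proper if adjacent vertices get distinct labels, and it is a closed coloring with remainder $k\bmod n$ if $\sum_{w\in N[v]}\ell(w)\equiv k\pmod n$ for every $v$, where $N[v]$ is the closed neighborhood of $v$. $\chi_{n,k}(G)$ exists iff a proper closed coloring with remainder $k\bmod n$ exists. -}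

module Defs where

open import Data.Nat as ℕ using (ℕ; zero; suc; _≤_; _<_; _<?_)
open import Data.Nat.Properties using (≤-trans; n≤1+n)
open import Data.Bool using (Bool; true; false)
open import Data.List using (List; []; _∷_; length; _++_; map; foldr)
open import Data.List.Membership.Propositional using (_∈_)
open import Data.Integer as ℤ using (ℤ; +_; _+_; _-_; _*_)
open import Data.Integer.Divisibility using (_∣_)
open import Data.Product using (Σ; _,_; proj₁; ∃-syntax)
open import Relation.Binary.PropositionalEquality using (_≡_; _≢_)
open import Relation.Nullary using (yes; no)

-- The perfect binary tree T_{2,d}.
-- A vertex is the path from the root, a list of left/right choices
-- (most recent choice first) of length ≤ d.

Vertex : ℕ → Set
Vertex d = Σ (List Bool) (λ p → length p ≤ d)

parents : ∀ {d} → Vertex d → List (Vertex d)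
parents ([] , _) = []
parents (b ∷ p , h) = (p , ≤-trans (n≤1+n (length p)) h) ∷ []

children : ∀ {d} → Vertex d → List (Vertex d)
children {d} (p , _) with suc (length p) ℕ.≤? d
... | yes lt = (false ∷ p , lt) ∷ (true ∷ p , lt) ∷ []
... | no _ = []

neighbours : ∀ {d} → Vertex d → List (Vertex d)
neighbours v = parents v ++ children v

Adj : ∀ {d} → Vertex d → Vertex d → Set
Adj u v = u ∈ neighbours v

Labeling : ℕ → Set
Labeling d = Vertex d → ℤ

closedSum : ∀ {d} → Labeling d → Vertex d → ℤ
closedSum ℓ v = ℓ v + foldr _+_ (+ 0) (map ℓ (neighbours v))

Proper : ∀ {d} → Labeling d → Set
Proper {d} ℓ = ∀ (u v : Vertex d) → Adj u v → ℓ u ≢ ℓ v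

_≡_[mod_] : ℤ → ℤ → ℕ → Set
a ≡ b [mod n ] = (+ n) ∣ (a - b)

ClosedColoring : (n : ℕ) (k : ℤ) → ∀ {d} → Labeling d → Set
ClosedColoring n k {d} ℓ = ∀ (v : Vertex d) → closedSum ℓ v ≡ k [mod n ]

ChiExists : (n : ℕ) (k : ℤ) (d : ℕ) → Set
ChiExists n k d = ∃[ ℓ ] (Proper {d} ℓ Data.Product.× ClosedColoring n k ℓ)

-- Coefficients f_i(α) of the formal power series
--   f(α,t) = ((k-α)t + α) / ((1-t)(2t²+t+1)).
-- Since (1-t)(2t²+t+1) = 1 + t² - 2t³, the coefficients are the unique
-- sequence with  f_i + f_{i-2} - 2 f_{i-3} = [t^i]((k-α)t+α)
-- (terms with negative index being 0).

numer : ℤ → ℤ → ℕ → ℤ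
numer k α 0 = α
numer k α 1 = k - α
numer k α (suc (suc _)) = + 0

fcoef : ℤ → ℤ → ℕ → ℤ
fcoef k α 0 = numer k α 0
fcoef k α 1 = numer k α 1
fcoef k α 2 = numer k α 2 - fcoef k α 0
fcoef k α (suc (suc (suc i))) =
  numer k α (3 ℕ.+ i) - fcoef k α (suc i) + (+ 2) * fcoef k α i

-- Say α represents a vertex v of height h when, modulo n, ℓ(v) ≡ f_h(α) and the label of
-- the parent of v (0 for the root) is ≡ f_{h+1}(α).  Because f(α,t)(1 + t + 2t²) equals
-- α + kt/(1 − t), we have f₀ + f₁ = k and f_{j+1} + f_{j+2} + 2f_j = k, which are exactly the
-- closed sums at a leaf and at an inner vertex (itself, its parent, two children).  Hence a
-- labelling in which one α represents every vertex is a closed coloring, and the empty parent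
-- sum at the root says f_{d+1}(α) ≡ 0.  Conversely, in a closed coloring each leaf v is
-- represented by ℓ(v), and if the two children of v are represented by α₀ and α₁ then v is
-- represented by their average modulo n, which exists because f_j(α) is affine in α with odd
-- slope.

module Submission where

open import Defs
open import Data.Nat using (ℕ; _≤_; suc)
open import Data.Integer using (ℤ; +_)
open import Data.Product using (∃-syntax)
open import Function.Bundles using (_⇔_; mk⇔)

open import Data.Bool using (Bool; true; false)
open import Data.Empty using (⊥-elim)
open import Data.Integer using (_+_; _-_; _*_; -_; ∣_∣; _%ℕ_; _/ℕ_)
import Data.Integer.Properties as ℤₚ
open import Data.Integer.DivMod using (a≡a%ℕn+[a/ℕn]*n; n%ℕd<d)
open import Data.Integer.Divisibility.Signed
  using (divides; ∣-refl; ∣ᵤ⇒∣; ∣⇒∣ᵤ; ∣m∣n⇒∣m+n; ∣m⇒∣-m; ∣n⇒∣m*n)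
  renaming (_∣_ to _∣ₛ_)
open import Data.Integer.Tactic.RingSolver using (solve-∀)
open import Data.List using (List; []; _∷_; length; _++_; map; foldr)
open import Data.List.Membership.Propositional using (_∈_)
open import Data.List.Membership.Propositional.Properties using (∈-++⁻)
open import Data.List.Relation.Unary.Any using (here; there)
import Data.Nat as ℕ
open import Data.Nat using (zero; _<_; _∸_; s≤s; z≤n; NonZero)
import Data.Nat.Properties as ℕₚ
open import Data.Product using (_,_; _×_; proj₂)
open import Data.Sum using (_⊎_; inj₁; inj₂)
open import Level using (0ℓ)
open import Relation.Binary.Bundles using (Setoid)
open import Relation.Binary.Structures using (IsEquivalence)
import Relation.Binary.Reasoning.Setoid as SetoidReasoning
open import Relation.Nullary using (¬_; Dec; yes; no)
open import Relation.Binary.PropositionalEquality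

module Congruence (n : ℕ) where

  infix 4 _≈_
  -- A record rather than a function, so that a and b can be inferred from a proof.
  record _≈_ (a b : ℤ) : Set where
    constructor mod-n
    field divides-difference : + n ∣ₛ a - b

  ≈-from : ∀ {a b x} → + n ∣ₛ x → a - b ≡ x → a ≈ b
  ≈-from n∣x a-b≡x = mod-n (subst (+ n ∣ₛ_) (sym a-b≡x) n∣x)

  ≈-by-multiple : ∀ {a b x} y → + n ∣ₛ x → a - b ≡ y * x → a ≈ b
  ≈-by-multiple y n∣x = ≈-from (∣n⇒∣m*n y n∣x)

  ≈-reflexive : ∀ {a b} → a ≡ b → a ≈ b
  ≈-reflexive {a} refl = ≈-from (divides (+ 0) refl) (ℤₚ.+-inverseʳ a)

  ≈-refl : ∀ {a} → a ≈ a
  ≈-refl = ≈-reflexive refl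

  ≈-sym : ∀ {a b} → a ≈ b → b ≈ a
  ≈-sym {a} {b} (mod-n n∣a-b) = ≈-from (∣m⇒∣-m n∣a-b) (identity a b)
    where
    identity : ∀ a b → b - a ≡ - (a - b)
    identity = solve-∀

  ≈-trans : ∀ {a b c} → a ≈ b → b ≈ c → a ≈ c
  ≈-trans {a} {b} {c} (mod-n n∣a-b) (mod-n n∣b-c) =
    ≈-from (∣m∣n⇒∣m+n n∣a-b n∣b-c) (identity a b c)
    where
    identity : ∀ a b c → a - c ≡ (a - b) + (b - c)
    identity = solve-∀

  +-cong : ∀ {a b c e} → a ≈ b → c ≈ e → a + c ≈ b + e
  +-cong {a} {b} {c} {e} (mod-n n∣a-b) (mod-n n∣c-e) =
    ≈-from (∣m∣n⇒∣m+n n∣a-b n∣c-e) (identity a b c e)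
    where
    identity : ∀ a b c e → (a + c) - (b + e) ≡ (a - b) + (c - e)
    identity = solve-∀

  +-cancelˡ : ∀ a {b c} → a + b ≈ a + c → b ≈ c
  +-cancelˡ a {b} {c} (mod-n n∣difference) = ≈-from n∣difference (identity a b c)
    where
    identity : ∀ a b c → b - c ≡ (a + b) - (a + c)
    identity = solve-∀

  +-cancelʳ : ∀ a {b c} → b + a ≈ c + a → b ≈ c
  +-cancelʳ a {b} {c} (mod-n n∣difference) = ≈-from n∣difference (identity a b c)
    where
    identity : ∀ a b c → b - c ≡ (b + a) - (c + a)
    identity = solve-∀

  ≈-isEquivalence : IsEquivalence _≈_
  ≈-isEquivalence = record { refl = ≈-refl ; sym = ≈-sym ; trans = ≈-trans }

  ≈-setoid : Setoid 0ℓ 0ℓ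
  ≈-setoid = record { isEquivalence = ≈-isEquivalence }

  module ≈-Reasoning = SetoidReasoning ≈-setoid

  ≡[mod]⇒≈ : ∀ {a b} → a ≡ b [mod n ] → a ≈ b
  ≡[mod]⇒≈ n∣a-b = mod-n (∣ᵤ⇒∣ n∣a-b)

  ≈⇒≡[mod] : ∀ {a b} → a ≈ b → a ≡ b [mod n ]
  ≈⇒≡[mod] (mod-n n∣a-b) = ∣⇒∣ᵤ n∣a-b

  a%ℕn+n*l≈a : .{{_ : NonZero n}} → ∀ a l → + (a %ℕ n ℕ.+ n ℕ.* l) ≈ a
  a%ℕn+n*l≈a a l = ≈-by-multiple (+ l - q) ∣-refl (begin
      + (r ℕ.+ n ℕ.* l) - a
        ≡⟨ cong₂ _-_ (ℤₚ.pos-+ r (n ℕ.* l)) (a≡a%ℕn+[a/ℕn]*n a n) ⟩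
      + r + + (n ℕ.* l) - (+ r + q * + n)
        ≡⟨ cong (λ t → + r + t - (+ r + q * + n)) (ℤₚ.pos-* n l) ⟩
      + r + + n * + l - (+ r + q * + n)
        ≡⟨ identity (+ r) (+ n) (+ l) q ⟩
      (+ l - q) * + n ∎)
    where
    open ≡-Reasoning
    r = a %ℕ n
    q = a /ℕ n
    identity : ∀ r n l q → r + n * l - (r + q * n) ≡ (l - q) * n
    identity = solve-∀

fcoef-init : ∀ k α → fcoef k α 0 + fcoef k α 1 ≡ k
fcoef-init k α = identity k α
  where
  identity : ∀ k α → α + (k - α) ≡ k
  identity = solve-∀

fcoef-recurrence : ∀ k α j →
  fcoef k α (suc j) + fcoef k α (suc (suc j)) + + 2 * fcoef k α j ≡ k
fcoef-recurrence k α zero = identity k α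
  where
  identity : ∀ k α → (k - α) + (+ 0 - α) + + 2 * α ≡ k
  identity = solve-∀
fcoef-recurrence k α (suc j) =
  trans (identity (fcoef k α (suc j)) (fcoef k α (suc (suc j))) (fcoef k α j))
        (fcoef-recurrence k α j)
  where
  identity : ∀ f₁ f₂ f₀ → f₂ + (+ 0 - f₁ + + 2 * f₀) + + 2 * f₁ ≡ f₁ + f₂ + + 2 * f₀
  identity = solve-∀

fcoef-affine : ∀ k α j → fcoef k α j ≡ fcoef k (+ 0) j + α * fcoef (+ 0) (+ 1) j
fcoef-affine k α 0 = identity α
  where
  identity : ∀ α → α ≡ + 0 + α * + 1
  identity = solve-∀
fcoef-affine k α 1 = identity k α
  where
  identity : ∀ k α → k - α ≡ (k - + 0) + α * (+ 0 - + 1)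
  identity = solve-∀
fcoef-affine k α 2 = identity α
  where
  identity : ∀ α → + 0 - α ≡ (+ 0 - + 0) + α * (+ 0 - + 1)
  identity = solve-∀
fcoef-affine k α (suc (suc (suc j)))
  rewrite fcoef-affine k α (suc j) | fcoef-affine k α j =
  identity (fcoef k (+ 0) (suc j)) (fcoef (+ 0) (+ 1) (suc j))
           (fcoef k (+ 0) j) (fcoef (+ 0) (+ 1) j) α
  where
  identity : ∀ a₁ b₁ a₀ b₀ α →
    + 0 - (a₁ + α * b₁) + + 2 * (a₀ + α * b₀) ≡ (+ 0 - a₁ + + 2 * a₀) + α * (+ 0 - b₁ + + 2 * b₀)
  identity = solve-∀

fcoef-slope-odd : ∀ j → ∃[ m ] fcoef (+ 0) (+ 1) j ≡ + 1 + + 2 * m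
fcoef-slope-odd 0 = + 0 , refl
fcoef-slope-odd 1 = - + 1 , refl
fcoef-slope-odd 2 = - + 1 , refl
fcoef-slope-odd (suc (suc (suc j)))
  with fcoef-slope-odd (suc j) | fcoef-slope-odd j
... | m₁ , b₁≡ | m₀ , b₀≡ rewrite b₁≡ | b₀≡ = + 2 * m₀ - m₁ , identity m₁ m₀
  where
  identity : ∀ m₁ m₀ → + 0 - (+ 1 + + 2 * m₁) + + 2 * (+ 1 + + 2 * m₀) ≡ + 1 + + 2 * (+ 2 * m₀ - m₁)
  identity = solve-∀

-- Since n ∣ (α₁ − α₀)(1 + 2m), the factor 1 + m acts as 1/2 on α₁ − α₀:
-- modulo n, the midpoint behaves like the average of α₀ and α₁.
midpoint : ℤ → ℤ → ℤ → ℤ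
midpoint m α₀ α₁ = α₀ + (α₁ - α₀) * (+ 1 + m)

module _ {n : ℕ} where
  open Congruence n

  odd-affine-midpoint : ∀ a c e m α₀ α₁ →
    a + α₀ * (+ 1 + + 2 * m) ≈ a + α₁ * (+ 1 + + 2 * m) →
    a + midpoint m α₀ α₁ * (+ 1 + + 2 * m) ≈ a + α₀ * (+ 1 + + 2 * m) ×
    + 2 * (c + midpoint m α₀ α₁ * e) ≈ (c + α₀ * e) + (c + α₁ * e)
  odd-affine-midpoint a c e m α₀ α₁ (mod-n n∣difference) =
    ≈-by-multiple (- (+ 1 + m)) n∣difference (slope-identity a m α₀ α₁) ,
    ≈-by-multiple (- e) n∣difference (offset-identity a c e m α₀ α₁)
    where
    slope-identity : ∀ a m α₀ α₁ →
      (a + (α₀ + (α₁ - α₀) * (+ 1 + m)) * (+ 1 + + 2 * m)) - (a + α₀ * (+ 1 + + 2 * m))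
        ≡ - (+ 1 + m) * ((a + α₀ * (+ 1 + + 2 * m)) - (a + α₁ * (+ 1 + + 2 * m)))
    slope-identity = solve-∀
    offset-identity : ∀ a c e m α₀ α₁ →
      + 2 * (c + (α₀ + (α₁ - α₀) * (+ 1 + m)) * e) - ((c + α₀ * e) + (c + α₁ * e))
        ≡ - e * ((a + α₀ * (+ 1 + + 2 * m)) - (a + α₁ * (+ 1 + + 2 * m)))
    offset-identity = solve-∀

  fcoef-midpoint : ∀ k i j {α₀ α₁} → fcoef k α₀ i ≈ fcoef k α₁ i →
    ∃[ α ] (fcoef k α i ≈ fcoef k α₀ i × + 2 * fcoef k α j ≈ fcoef k α₀ j + fcoef k α₁ j)
  fcoef-midpoint k i j {α₀} {α₁} fᵢα₀≈fᵢα₁ = via-odd-slope (fcoef-slope-odd i)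
    where
    via-odd-slope : ∃[ m ] fcoef (+ 0) (+ 1) i ≡ + 1 + + 2 * m →
      ∃[ α ] (fcoef k α i ≈ fcoef k α₀ i × + 2 * fcoef k α j ≈ fcoef k α₀ j + fcoef k α₁ j)
    via-odd-slope (m , slopeᵢ≡) =
      let fᵢ≈ , 2fⱼ≈ = odd-affine-midpoint (fcoef k (+ 0) i) (fcoef k (+ 0) j)
                         (fcoef (+ 0) (+ 1) j) m α₀ α₁
                         (subst₂ _≈_ (affineᵢ α₀) (affineᵢ α₁) fᵢα₀≈fᵢα₁)
      in midpoint m α₀ α₁ ,
         subst₂ _≈_ (sym (affineᵢ _)) (sym (affineᵢ α₀)) fᵢ≈ ,
         subst₂ (λ x y → + 2 * x ≈ y) (sym (fcoef-affine k _ j))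
           (sym (cong₂ _+_ (fcoef-affine k α₀ j) (fcoef-affine k α₁ j))) 2fⱼ≈
      where
      affineᵢ : ∀ α → fcoef k α i ≡ fcoef k (+ 0) i + α * (+ 1 + + 2 * m)
      affineᵢ α = trans (fcoef-affine k α i) (cong (λ b → fcoef k (+ 0) i + α * b) slopeᵢ≡)

m<n⇒n∸m≡1+[n∸1+m] : ∀ {m n} → m < n → n ∸ m ≡ suc (n ∸ suc m)
m<n⇒n∸m≡1+[n∸1+m] {zero}  {suc n} _         = refl
m<n⇒n∸m≡1+[n∸1+m] {suc m} {suc n} (s≤s m<n) = m<n⇒n∸m≡1+[n∸1+m] m<n

r<n⇒r+n*l<s+n*[1+l] : ∀ {r n} s l → r < n → r ℕ.+ n ℕ.* l < s ℕ.+ n ℕ.* suc l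
r<n⇒r+n*l<s+n*[1+l] {r} {n} s l r<n = ℕₚ.<-≤-trans (ℕₚ.+-monoˡ-< (n ℕ.* l) r<n) (begin
  n ℕ.+ n ℕ.* l   ≡⟨ ℕₚ.*-suc n l ⟨
  n ℕ.* suc l     ≤⟨ ℕₚ.m≤n+m (n ℕ.* suc l) s ⟩
  s ℕ.+ n ℕ.* suc l ∎)
  where open ℕₚ.≤-Reasoning

module _ {d : ℕ} where

  level : Vertex d → ℕ
  level (p , _) = length p

  height : Vertex d → ℕ
  height v = d ∸ level v

  labelSum : Labeling d → List (Vertex d) → ℤ
  labelSum ℓ vs = foldr _+_ (+ 0) (map ℓ vs)

  parentSum : Labeling d → Vertex d → ℤ
  parentSum ℓ v = labelSum ℓ (parents v)

  labelSum-++ : ∀ ℓ us vs → labelSum ℓ (us ++ vs) ≡ labelSum ℓ us + labelSum ℓ vs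
  labelSum-++ ℓ []       vs = sym (ℤₚ.+-identityˡ _)
  labelSum-++ ℓ (u ∷ us) vs = trans (cong (λ t → ℓ u + t) (labelSum-++ ℓ us vs))
                                    (sym (ℤₚ.+-assoc (ℓ u) _ _))

  children-inner : ∀ {p} (prf : length p ≤ d) (lt : suc (length p) ≤ d) →
    children (p , prf) ≡ (false ∷ p , lt) ∷ (true ∷ p , lt) ∷ []
  children-inner {p} prf lt with suc (length p) ℕ.≤? d
  ... | yes lt′ = cong (λ q → (false ∷ p , q) ∷ (true ∷ p , q) ∷ []) (ℕₚ.≤-irrelevant lt′ lt)
  ... | no ¬lt  = ⊥-elim (¬lt lt)

  children-leaf : ∀ {p} (prf : length p ≤ d) → ¬ suc (length p) ≤ d → children (p , prf) ≡ []
  children-leaf {p} prf ¬lt with suc (length p) ℕ.≤? d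
  ... | yes lt = ⊥-elim (¬lt lt)
  ... | no _   = refl

  closedSum-split : ∀ ℓ v → closedSum ℓ v ≡ ℓ v + (parentSum ℓ v + labelSum ℓ (children v))
  closedSum-split ℓ v = cong (λ t → ℓ v + t) (labelSum-++ ℓ (parents v) (children v))

  closedSum-inner : ∀ ℓ {p} (prf : length p ≤ d) (lt : suc (length p) ≤ d) →
    closedSum ℓ (p , prf) ≡
    ℓ (p , prf) + parentSum ℓ (p , prf) + (ℓ (false ∷ p , lt) + ℓ (true ∷ p , lt))
  closedSum-inner ℓ {p} prf lt = begin
    closedSum ℓ v
      ≡⟨ closedSum-split ℓ v ⟩
    ℓ v + (parentSum ℓ v + labelSum ℓ (children v))
      ≡⟨ cong (λ cs → ℓ v + (parentSum ℓ v + labelSum ℓ cs)) (children-inner prf lt) ⟩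
    ℓ v + (parentSum ℓ v + (ℓ (false ∷ p , lt) + (ℓ (true ∷ p , lt) + + 0)))
      ≡⟨ identity (ℓ v) (parentSum ℓ v) (ℓ (false ∷ p , lt)) (ℓ (true ∷ p , lt)) ⟩
    ℓ v + parentSum ℓ v + (ℓ (false ∷ p , lt) + ℓ (true ∷ p , lt)) ∎
    where
    open ≡-Reasoning
    v : Vertex d
    v = (p , prf)
    identity : ∀ a b c e → a + (b + (c + (e + + 0))) ≡ a + b + (c + e)
    identity = solve-∀

  closedSum-leaf : ∀ ℓ {p} (prf : length p ≤ d) → ¬ suc (length p) ≤ d →
    closedSum ℓ (p , prf) ≡ ℓ (p , prf) + parentSum ℓ (p , prf)
  closedSum-leaf ℓ {p} prf ¬lt = begin
    closedSum ℓ v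
      ≡⟨ closedSum-split ℓ v ⟩
    ℓ v + (parentSum ℓ v + labelSum ℓ (children v))
      ≡⟨ cong (λ cs → ℓ v + (parentSum ℓ v + labelSum ℓ cs)) (children-leaf prf ¬lt) ⟩
    ℓ v + (parentSum ℓ v + + 0)
      ≡⟨ cong (λ t → ℓ v + t) (ℤₚ.+-identityʳ _) ⟩
    ℓ v + parentSum ℓ v ∎
    where
    open ≡-Reasoning
    v : Vertex d
    v = (p , prf)

  parentSum-child : ∀ ℓ {b p} (prf : length p ≤ d) (lt : suc (length p) ≤ d) →
    parentSum ℓ (b ∷ p , lt) ≡ ℓ (p , prf)
  parentSum-child ℓ {p = p} prf lt =
    trans (ℤₚ.+-identityʳ _) (cong (λ q → ℓ (p , q)) (ℕₚ.≤-irrelevant _ prf))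

  height-parent : ∀ b p (prf : length p ≤ d) (lt : suc (length p) ≤ d) →
    height (p , prf) ≡ suc (height (b ∷ p , lt))
  height-parent _ _ _ lt = m<n⇒n∸m≡1+[n∸1+m] lt

  height-leaf : ∀ p (prf : length p ≤ d) → ¬ suc (length p) ≤ d → height (p , prf) ≡ 0
  height-leaf _ _ ¬lt = ℕₚ.m≤n⇒m∸n≡0 (ℕₚ.≮⇒≥ ¬lt)

  level-child : ∀ {u p} (prf : length p ≤ d) → u ∈ children (p , prf) → level u ≡ suc (length p)
  level-child {u} {p} prf = by-cases (suc (length p) ℕ.≤? d)
    where
    by-cases : Dec (suc (length p) ≤ d) → u ∈ children (p , prf) → level u ≡ suc (length p)
    by-cases (yes lt) u∈children with subst (u ∈_) (children-inner prf lt) u∈children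
    ... | here refl         = refl
    ... | there (here refl) = refl
    by-cases (no ¬lt) u∈children with subst (u ∈_) (children-leaf prf ¬lt) u∈children
    ... | ()

  adjacent-levels : ∀ {u v : Vertex d} → Adj u v →
    level u ≡ suc (level v) ⊎ level v ≡ suc (level u)
  adjacent-levels {u} {p , prf} u∈N[v] with ∈-++⁻ (parents (p , prf)) u∈N[v]
  adjacent-levels {u} {[] , prf}    _ | inj₁ ()
  adjacent-levels {u} {b ∷ q , prf} _ | inj₁ (here refl) = inj₂ refl
  adjacent-levels {u} {p , prf}     _ | inj₂ u∈children = inj₁ (level-child prf u∈children)

module _ (n : ℕ) (k : ℤ) {d : ℕ} (ℓ : Labeling d) where
  open Congruence n
  open ≈-Reasoning

  record Represents (h : ℕ) (α : ℤ) (v : Vertex d) : Set where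
    constructor mkRepresents
    field
      label≈  : ℓ v ≈ fcoef k α h
      parent≈ : parentSum ℓ v ≈ fcoef k α (suc h)

  closed-inner : ∀ {α h p} (prf : length p ≤ d) (lt : suc (length p) ≤ d) →
    Represents (suc h) α (p , prf) →
    Represents h α (false ∷ p , lt) → Represents h α (true ∷ p , lt) →
    closedSum ℓ (p , prf) ≈ k
  closed-inner {α} {h} {p} prf lt (mkRepresents ℓv≈ Pv≈) (mkRepresents ℓc₀≈ _) (mkRepresents ℓc₁≈ _) = begin
    closedSum ℓ (p , prf)
      ≡⟨ closedSum-inner ℓ prf lt ⟩
    ℓ (p , prf) + parentSum ℓ (p , prf) + (ℓ (false ∷ p , lt) + ℓ (true ∷ p , lt))
      ≈⟨ +-cong (+-cong ℓv≈ Pv≈) (+-cong ℓc₀≈ ℓc₁≈) ⟩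
    f (suc h) + f (suc (suc h)) + (f h + f h)
      ≡⟨ cong (λ t → f (suc h) + f (suc (suc h)) + t) (twice (f h)) ⟩
    f (suc h) + f (suc (suc h)) + + 2 * f h
      ≡⟨ fcoef-recurrence k α h ⟩
    k ∎
    where
    f : ℕ → ℤ
    f = fcoef k α
    twice : ∀ x → x + x ≡ + 2 * x
    twice = solve-∀

  closed-leaf : ∀ {α p} (prf : length p ≤ d) → ¬ suc (length p) ≤ d →
    Represents 0 α (p , prf) → closedSum ℓ (p , prf) ≈ k
  closed-leaf {α} {p} prf ¬lt (mkRepresents ℓv≈ Pv≈) = begin
    closedSum ℓ (p , prf)                ≡⟨ closedSum-leaf ℓ prf ¬lt ⟩
    ℓ (p , prf) + parentSum ℓ (p , prf)  ≈⟨ +-cong ℓv≈ Pv≈ ⟩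
    fcoef k α 0 + fcoef k α 1            ≡⟨ fcoef-init k α ⟩
    k                                    ∎

  represents⇒closed : ∀ {α} → (∀ v → Represents (height v) α v) → ClosedColoring n k ℓ
  represents⇒closed {α} represents (p , prf) = ≈⇒≡[mod] (by-cases (suc (length p) ℕ.≤? d))
    where
    represents-at : ∀ {h} → height (p , prf) ≡ h → Represents h α (p , prf)
    represents-at eq = subst (λ h → Represents h α (p , prf)) eq (represents (p , prf))
    by-cases : Dec (suc (length p) ≤ d) → closedSum ℓ (p , prf) ≈ k
    by-cases (yes lt) = closed-inner prf lt (represents-at (height-parent false p prf lt))
                          (represents (false ∷ p , lt)) (represents (true ∷ p , lt))
    by-cases (no ¬lt) = closed-leaf prf ¬lt (represents-at (height-leaf p prf ¬lt))

  module _ (closed : ClosedColoring n k ℓ) where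

    represents-leaf : ∀ {p} (prf : length p ≤ d) → ¬ suc (length p) ≤ d →
      Represents 0 (ℓ (p , prf)) (p , prf)
    represents-leaf {p} prf ¬lt = mkRepresents ≈-refl (+-cancelˡ (ℓ (p , prf)) (begin
      ℓ (p , prf) + parentSum ℓ (p , prf)  ≡⟨ closedSum-leaf ℓ prf ¬lt ⟨
      closedSum ℓ (p , prf)                ≈⟨ ≡[mod]⇒≈ (closed (p , prf)) ⟩
      k                                    ≡⟨ fcoef-init k (ℓ (p , prf)) ⟨
      ℓ (p , prf) + fcoef k (ℓ (p , prf)) 1 ∎))

    represents-inner : ∀ {h α₀ α₁ p} (prf : length p ≤ d) (lt : suc (length p) ≤ d) →
      Represents h α₀ (false ∷ p , lt) → Represents h α₁ (true ∷ p , lt) →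
      ∃[ α ] Represents (suc h) α (p , prf)
    represents-inner {h} {α₀} {α₁} {p} prf lt
      (mkRepresents ℓc₀≈ Pc₀≈) (mkRepresents ℓc₁≈ Pc₁≈) =
      let α , fα≈fα₀ , 2fα≈ = fcoef-midpoint k (suc h) h (≈-trans (≈-sym ℓv≈fα₀) ℓv≈fα₁)
          ℓv≈fα = ≈-trans ℓv≈fα₀ (≈-sym fα≈fα₀)
      in α , mkRepresents ℓv≈fα (+-cancelˡ (fcoef k α (suc h)) (+-cancelʳ (+ 2 * fcoef k α h) (begin
        fcoef k α (suc h) + parentSum ℓ v + + 2 * fcoef k α h
          ≈⟨ +-cong (+-cong (≈-sym ℓv≈fα) ≈-refl) (≈-trans 2fα≈ (≈-sym (+-cong ℓc₀≈ ℓc₁≈))) ⟩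
        ℓ v + parentSum ℓ v + (ℓ (false ∷ p , lt) + ℓ (true ∷ p , lt))
          ≡⟨ closedSum-inner ℓ prf lt ⟨
        closedSum ℓ v
          ≈⟨ ≡[mod]⇒≈ (closed v) ⟩
        k
          ≡⟨ fcoef-recurrence k α h ⟨
        fcoef k α (suc h) + fcoef k α (suc (suc h)) + + 2 * fcoef k α h ∎)))
      where
      v : Vertex d
      v = (p , prf)
      ℓv≈fα₀ : ℓ v ≈ fcoef k α₀ (suc h)
      ℓv≈fα₀ = subst (_≈ fcoef k α₀ (suc h)) (parentSum-child ℓ {false} prf lt) Pc₀≈
      ℓv≈fα₁ : ℓ v ≈ fcoef k α₁ (suc h)
      ℓv≈fα₁ = subst (_≈ fcoef k α₁ (suc h)) (parentSum-child ℓ {true} prf lt) Pc₁≈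

    closed⇒represents : ∀ h v → height v ≡ h → ∃[ α ] Represents h α v
    closed⇒represents zero (p , prf) height≡0 =
      ℓ (p , prf) , represents-leaf prf (ℕₚ.≤⇒≯ (ℕₚ.m∸n≡0⇒m≤n height≡0))
    closed⇒represents (suc h) (p , prf) height≡1+h =
      represents-inner prf lt (proj₂ (closed⇒represents h (false ∷ p , lt) height-child≡h))
                              (proj₂ (closed⇒represents h (true ∷ p , lt) height-child≡h))
      where
      lt : suc (length p) ≤ d
      lt = ℕₚ.m∸n≢0⇒n<m (λ height≡0 → ℕₚ.0≢1+n (trans (sym height≡0) height≡1+h))
      height-child≡h : d ∸ suc (length p) ≡ h
      height-child≡h = ℕₚ.suc-injective (trans (sym (height-parent false p prf lt)) height≡1+h)

    closed⇒fcoef-root≡0 : ∃[ α ] fcoef k α (suc d) ≡ + 0 [mod n ]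
    closed⇒fcoef-root≡0 =
      let α , mkRepresents _ root≈ = closed⇒represents d ([] , z≤n) refl
      in α , ≈⇒≡[mod] (≈-sym root≈)

module _ (n : ℕ) .{{_ : NonZero n}} (k α : ℤ) {d : ℕ} where
  open Congruence n

  -- Adding n · level keeps the residue f_height(α) mod n and makes the label
  -- of a vertex strictly smaller than the labels of its children.
  coefficientLabeling : Labeling d
  coefficientLabeling v = + (fcoef k α (height v) %ℕ n ℕ.+ n ℕ.* level v)

  coefficientLabeling-< : ∀ u v → level v ≡ suc (level u) →
    ∣ coefficientLabeling u ∣ < ∣ coefficientLabeling v ∣
  coefficientLabeling-< u v eq = subst (λ l → residue u ℕ.+ n ℕ.* level u < residue v ℕ.+ n ℕ.* l)
    (sym eq) (r<n⇒r+n*l<s+n*[1+l] (residue v) (level u) (n%ℕd<d (fcoef k α (height u)) n))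
    where
    residue : Vertex d → ℕ
    residue w = fcoef k α (height w) %ℕ n

  coefficientLabeling-proper : Proper coefficientLabeling
  coefficientLabeling-proper u v u∼v ℓu≡ℓv with adjacent-levels u∼v
  ... | inj₁ u-below-v = ℕₚ.<-irrefl (sym (cong ∣_∣ ℓu≡ℓv)) (coefficientLabeling-< v u u-below-v)
  ... | inj₂ v-below-u = ℕₚ.<-irrefl (cong ∣_∣ ℓu≡ℓv) (coefficientLabeling-< u v v-below-u)

  coefficientLabeling-represents : fcoef k α (suc d) ≡ + 0 [mod n ] →
    ∀ v → Represents n k coefficientLabeling (height v) α v
  coefficientLabeling-represents root≡0 v =
    mkRepresents (a%ℕn+n*l≈a (fcoef k α (height v)) (level v)) (parent≈ v)
    where
    open ≈-Reasoning
    parent≈ : ∀ v → parentSum coefficientLabeling v ≈ fcoef k α (suc (height v))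
    parent≈ ([] , _)     = ≈-sym (≡[mod]⇒≈ root≡0)
    parent≈ (b ∷ p , lt) = begin
      parentSum coefficientLabeling (b ∷ p , lt)  ≡⟨ parentSum-child coefficientLabeling {b} {p} prf lt ⟩
      coefficientLabeling (p , prf)               ≈⟨ a%ℕn+n*l≈a (fcoef k α (height (p , prf))) (length p) ⟩
      fcoef k α (height (p , prf))                ≡⟨ cong (fcoef k α) (height-parent b p prf lt) ⟩
      fcoef k α (suc (height (b ∷ p , lt)))       ∎
      where
      prf : length p ≤ d
      prf = ℕₚ.≤-trans (ℕₚ.n≤1+n (length p)) lt

theorem6p5 : (k : ℤ) (n d : ℕ) → 1 ≤ n → 1 ≤ d →
    ChiExists n k d ⇔ (∃[ α ] (fcoef k α (suc d) ≡ + 0 [mod n ]))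
theorem6p5 k n@(suc _) d _ _ = mk⇔
  (λ (ℓ , _ , closed) → closed⇒fcoef-root≡0 n k ℓ closed)
  (λ (α , root≡0) →
    coefficientLabeling n k α ,
    coefficientLabeling-proper n k α ,
    represents⇒closed n k (coefficientLabeling n k α)
      (coefficientLabeling-represents n k α root≡0))
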